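{- The only odd pristine positive integer is $1$; that is, if $n > 1$ is odd then $a(n) \neq n$.
   Context: For positive integers, write $m \lfloor n$ to mean that $m$ is a proper divisor of $n$. The number of recursive divisors is defined by $a(1)=1$ and $a(n) = 1 + \sum_{m \lfloor n} a(m)$ for $n>1$. A positive integer $n$ is pristine if $a(n) = n$. -}

module Defs where

open import Data.Nat using (ℕ; zero; suc; _+_; _<_; s≤s; z≤n)
open import Data.Nat.Properties using (≤-refl; m≤n⇒m≤1+n)
open import Data.Nat.Divisibility using (_∣_; _∣?_)
open import Data.Nat.Induction using (<-rec)
open import Relation.Nullary using (yes; no)
open import Relation.Binary.PropositionalEquality using (_≡_)

-- Sum over the proper divisors m of n with 1 ≤ m < n, given a function
-- defined on all m < n (strong recursion).
-- sumProperDiv n k f = Σ_{1 ≤ m ≤ k, m ∣ n} f m, for k < n.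
sumDivUpTo : (n k : ℕ) → ({m : ℕ} → m < n → ℕ) → k < n → ℕ
sumDivUpTo n zero    f _ = 0
sumDivUpTo n (suc k) f k<n with suc k ∣? n
... | yes _ = f {suc k} k<n + sumDivUpTo n k f (m≤n⇒m≤1+n' k<n)
  where
  m≤n⇒m≤1+n' : suc k < n → k < n
  m≤n⇒m≤1+n' (s≤s p) = m≤n⇒m≤1+n p
... | no _  = sumDivUpTo n k f (m≤n⇒m≤1+n' k<n)
  where
  m≤n⇒m≤1+n' : suc k < n → k < n
  m≤n⇒m≤1+n' (s≤s p) = m≤n⇒m≤1+n p

-- Number of recursive divisors: a(n) = 1 + Σ_{m proper divisor of n} a(m)
-- for n ≥ 1 (this gives a(1) = 1, empty sum).  a(0) = 0 is a junk value.
a : ℕ → ℕ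
a = <-rec (λ _ → ℕ) step
  where
  step : (n : ℕ) → ({m : ℕ} → m < n → ℕ) → ℕ
  step zero    _   = 0
  step (suc k) rec = 1 + sumDivUpTo (suc k) k rec ≤-refl

Pristine : ℕ → Set
Pristine n = a n ≡ n

private
  open import Relation.Binary.PropositionalEquality using (refl)
  t1 : a 1 ≡ 1
  t1 = refl
  t6 : a 6 ≡ 6
  t6 = refl
  t9 : a 9 ≡ 4
  t9 = refl

{-# OPTIONS --safe #-}
-- For n > 1 the divisor 1 contributes a(1) = 1 to the sum in the recurrence
-- and, by strong induction, every other proper divisor m > 1 contributes an
-- even a(m); so the sum is odd and a(n) = 1 + sum is even.
module Submission where

open import Defs
open import Data.Nat using (ℕ; zero; suc; _+_; _<_; s≤s; z≤n)
open import Data.Nat.Properties using (≤-refl; +-suc)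
open import Data.Nat.Divisibility using (_∣_; _∣?_; ∣-refl; 1∣_; ∣m∣n⇒∣m+n)
open import Data.Nat.Induction using (<-rec; <-wellFounded)
open import Induction.WellFounded using (Acc; acc; acc-inverse; module Some; module FixPoint)
open import Relation.Nullary using (¬_; yes; no; contradiction)
open import Relation.Binary.PropositionalEquality using (_≡_; refl; cong; cong₂; trans; sym; subst)
open Relation.Binary.PropositionalEquality.≡-Reasoning

sumDivUpTo-cong : ∀ n k {g h : {m : ℕ} → m < n → ℕ} →
                  (∀ m (m<n : m < n) → g m<n ≡ h m<n) →
                  (k<n : k < n) → sumDivUpTo n k g k<n ≡ sumDivUpTo n k h k<n
sumDivUpTo-cong n zero    g≗h k<n = refl
sumDivUpTo-cong n (suc k) g≗h k<n with suc k ∣? n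
... | yes _ = cong₂ _+_ (g≗h (suc k) k<n) (sumDivUpTo-cong n k g≗h _)
... | no _  = sumDivUpTo-cong n k g≗h _

sumDivUpTo-odd : ∀ {n} (f : ℕ → ℕ) → f 1 ≡ 1 → (∀ {m} → 1 < m → m < n → 2 ∣ f m) →
                 ∀ k (1+k<n : suc k < n) → 2 ∣ 1 + sumDivUpTo n (suc k) (λ {m} _ → f m) 1+k<n
sumDivUpTo-odd {n} f f1≡1 even zero 1<n with 1 ∣? n
... | yes _  = subst (λ v → 2 ∣ 1 + (v + 0)) (sym f1≡1) ∣-refl
... | no 1∤n = contradiction (1∣ n) 1∤n
sumDivUpTo-odd {n} f f1≡1 even (suc k) 2+k<n with suc (suc k) ∣? n
... | yes _ = subst (2 ∣_) (+-suc (f (suc (suc k))) _)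
                (∣m∣n⇒∣m+n (even (s≤s (s≤s z≤n)) 2+k<n) (sumDivUpTo-odd f f1≡1 even k _))
... | no _  = sumDivUpTo-odd f f1≡1 even k _

RecursionStep : Set
RecursionStep = (n : ℕ) → ({m : ℕ} → m < n → ℕ) → ℕ

module _ {f : RecursionStep}
         (f-zero : (g : {m : ℕ} → m < 0 → ℕ) → f 0 g ≡ 0)
         (f-suc : ∀ k (g : {m : ℕ} → m < suc k → ℕ) → f (suc k) g ≡ 1 + sumDivUpTo (suc k) k g ≤-refl)
         where

  private
    f-ext : ∀ n {g h : {m : ℕ} → m < n → ℕ} → (∀ {m} (m<n : m < n) → g m<n ≡ h m<n) → f n g ≡ f n h
    f-ext zero    {g} {h} _   = trans (f-zero (λ {m} → g {m})) (sym (f-zero (λ {m} → h {m})))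
    f-ext (suc k) {g} {h} g≗h = begin
      f (suc k) g                        ≡⟨ f-suc k (λ {m} → g {m}) ⟩
      1 + sumDivUpTo (suc k) k g ≤-refl  ≡⟨ cong suc (sumDivUpTo-cong (suc k) k (λ _ → g≗h) ≤-refl) ⟩
      1 + sumDivUpTo (suc k) k h ≤-refl  ≡⟨ sym (f-suc k (λ {m} → h {m})) ⟩
      f (suc k) h                        ∎

    open FixPoint <-wellFounded (λ _ → ℕ) f f-ext

  wfRecBuilder-unfold : ∀ {k} (q : Acc _<_ (suc k)) →
    1 + sumDivUpTo (suc k) k (Some.wfRecBuilder (λ _ → ℕ) f (suc k) q) ≤-refl ≡ <-rec (λ _ → ℕ) f (suc k)
  wfRecBuilder-unfold {k} q@(acc rs) = begin
    1 + sumDivUpTo (suc k) k (Some.wfRecBuilder (λ _ → ℕ) f (suc k) q) ≤-refl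
      ≡⟨ cong suc (sumDivUpTo-cong (suc k) k
           (λ m m<n → some-wfRec-irrelevant m (rs m<n) (<-wellFounded m)) ≤-refl) ⟩
    1 + sumDivUpTo (suc k) k (λ {m} _ → <-rec (λ _ → ℕ) f m) ≤-refl
      ≡⟨ sym (f-suc k _) ⟩
    f (suc k) (λ {m} _ → <-rec (λ _ → ℕ) f m)
      ≡⟨ sym unfold-wfRec ⟩
    <-rec (λ _ → ℕ) f (suc k) ∎

-- The step function of a is local to Defs and cannot be named; it is found by
-- unification from the recursive calls inside a (suc k), which are stuck on
-- the accessibility proof acc-inverse (<-wellFounded (suc k)) m<n.
a-suc : ∀ k → a (suc k) ≡ 1 + sumDivUpTo (suc k) k (λ {m} _ → a m) ≤-refl
a-suc k = cong suc (sumDivUpTo-cong (suc k) k (λ where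
    zero    _   → refl
    (suc j) m<n → wfRecBuilder-unfold (λ _ → refl) (λ _ _ → refl)
                    (acc-inverse (<-wellFounded (suc k)) m<n)) ≤-refl)

a-even : ∀ n → 1 < n → 2 ∣ a n
a-even = <-rec (λ n → 1 < n → 2 ∣ a n) λ where
  (suc zero)    _   (s≤s ())
  (suc (suc k)) rec _ → subst (2 ∣_) (sym (a-suc (suc k)))
                          (sumDivUpTo-odd a refl (λ 1<m m<n → rec m<n 1<m) k ≤-refl)

theorem3 : (n : ℕ) → 1 < n → ¬ (2 ∣ n) → ¬ Pristine n
theorem3 n 1<n 2∤n a[n]≡n = 2∤n (subst (2 ∣_) a[n]≡n (a-even n 1<n))
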